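{- Let $H=(X,\mathcal{B})$ be an $(n,k,p,t;j)$-lottery design with $j\ge n/k$. Then there exists an $(n,k,p,t;j)$-lottery design $H_0=(X,\mathcal{B}_0)$ on the same vertex set with $\bigcup\mathcal{B}_0=X$, i.e. with no vertex of degree $0$.
   Context: Integers satisfy $n\ge k\ge t\ge 2$. An $(n,k,p,t;j)$-lottery design is a $k$-uniform hypergraph $(X,\mathcal{B})$ (all blocks of size $k$) with $|X|=n$, $|\mathcal{B}|=j$, such that every $D\subseteq X$ with $|D|=p$ satisfies $|B\cap D|\ge t$ for some $B\in\mathcal{B}$. The degree of a vertex is the number of blocks containing it. -}

module Defs where

open import Data.Nat using (ℕ; _≤_; _*_)
open import Data.Fin using (Fin)
open import Data.Fin.Subset using (Subset; ∣_∣; _∩_; _∈_)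
open import Data.List using (List; length)
open import Data.List.Relation.Unary.All using (All)
open import Data.List.Relation.Unary.Any using (Any)
open import Data.List.Relation.Unary.Unique.Propositional using (Unique)
open import Data.Product using (_×_)
open import Relation.Binary.PropositionalEquality using (_≡_)

IsUniformHypergraph : (n k j : ℕ) → List (Subset n) → Set
IsUniformHypergraph n k j 𝓑 =
  Unique 𝓑 × (length 𝓑 ≡ j) × All (λ B → ∣ B ∣ ≡ k) 𝓑

IsLotteryDesign : (n k p t j : ℕ) → List (Subset n) → Set
IsLotteryDesign n k p t j 𝓑 =
  IsUniformHypergraph n k j 𝓑 ×
  ((D : Subset n) → ∣ D ∣ ≡ p → Any (λ B → t ≤ ∣ B ∩ D ∣) 𝓑)

Covers : {n : ℕ} → List (Subset n) → Set
Covers {n} 𝓑 = (x : Fin n) → Any (λ B → x ∈ B) 𝓑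

module Submission where

-- If some vertex x lies in no block, then |⋃𝓑| < n ≤ jk = Σ|B|, so some vertex y lies in two
-- blocks B and B'. Exchanging y for x in B keeps every block of size k, keeps the blocks
-- distinct (only the new block contains x) and keeps the lottery property, while the union of
-- the blocks grows by x (y is still covered by B'). At most n such exchanges give a covering design.

open import Defs
open import Data.Nat using (ℕ; suc; zero; _+_; _*_; _≤_; _<_; z≤n)
open import Data.Nat.Properties
  using (≤-trans; ≤-reflexive; +-suc; +-monoʳ-≤; <⇒≱; m≤m+n; module ≤-Reasoning)
open import Data.Nat.ListAction using (sum)
open import Data.Fin as Fin using (Fin; _≟_)
open import Data.Fin.Properties using (all?; ¬∀⟶∃¬)
open import Data.Fin.Subset
  using (Subset; inside; outside; ∣_∣; _∩_; _∪_; _∈_; _∉_; _⊆_; _⊂_; ⋃; ⊤; Empty)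
open import Data.Fin.Subset.Properties
  using ( _∈?_; ∈⊤; ∣⊤∣≡n; p⊆q⇒∣p∣≤∣q∣; p⊂q⇒∣p∣<∣q∣; p⊆p∪q; q⊆p∪q; x∈p∪q⁻
        ; x∈p∩q⁺; x∈p∩q⁻; ∉⊥; drop-∷-Empty; nonempty?; ∪-isCommutativeMonoid)
open import Data.Vec using (Vec; _∷_; []; _[_]≔_; _[_]=_; here; there)
open import Data.Vec.Properties
  using ([]=-injective; []≔-updates; []≔-minimal; []=⇒lookup; lookup⇒[]=; lookup∘updateAt′)
open import Data.List using (List; _∷_; []; map; length)
open import Data.List.Relation.Unary.All as All using (All; _∷_; [])
open import Data.List.Relation.Unary.All.Properties using (¬Any⇒All¬)
open import Data.List.Relation.Unary.Any as Any using (Any; any?)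
open import Data.List.Relation.Unary.AllPairs using (_∷_)
open import Data.List.Relation.Binary.Permutation.Propositional using (_↭_; ↭-refl; ↭-sym; ↭-trans; prep; swap; ↭⇒↭ₛ)
open import Data.List.Relation.Binary.Permutation.Propositional.Properties
  using (All-resp-↭; Any-resp-↭; ↭-length)
open import Data.List.Relation.Binary.Permutation.Setoid.Properties using (Unique-resp-↭; foldr-commMonoid)
open import Data.Product using (Σ; ∃; _×_; _,_; proj₁; proj₂)
open import Data.Sum using (_⊎_; inj₁; inj₂)
open import Function using (_∘_)
open import Relation.Nullary using (¬_; yes; no; contradiction)
open import Relation.Binary.PropositionalEquality
  using (_≡_; _≢_; refl; sym; trans; cong; cong₂; subst; setoid; module ≡-Reasoning)

private
  variable
    n : ℕ

replace : Subset n → Fin n → Fin n → Subset n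
replace p y x = p [ y ]≔ outside [ x ]≔ inside

[]≔-minimal⁻ : ∀ {A : Set} (xs : Vec A n) {i j a b} → i ≢ j → (xs [ j ]≔ b) [ i ]= a → xs [ i ]= a
[]≔-minimal⁻ xs {i} {j} i≢j xs′[i]=a =
  lookup⇒[]= i xs (trans (sym (lookup∘updateAt′ i j i≢j xs)) ([]=⇒lookup xs′[i]=a))

x∈replace : ∀ (p : Subset n) y x → x ∈ replace p y x
x∈replace p y x = []≔-updates (p [ y ]≔ outside) x

∈-replace⁺ : ∀ {p : Subset n} {y x z} → z ≢ y → z ∈ p → z ∈ replace p y x
∈-replace⁺ {p = p} {y} {x} {z} z≢y z∈p with z ≟ x
... | yes refl = x∈replace p y z
... | no z≢x = []≔-minimal _ z x z≢x ([]≔-minimal p z y z≢y z∈p)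

∈-replace⁻ : ∀ {p : Subset n} {y x z} → z ∈ replace p y x → z ≡ x ⊎ (z ≢ y × z ∈ p)
∈-replace⁻ {p = p} {y} {x} {z} z∈p′ with z ≟ x
... | yes z≡x = inj₁ z≡x
... | no z≢x = inj₂ (z≢y , []≔-minimal⁻ p z≢y z∈p[y]≔outside)
  where
  z∈p[y]≔outside : z ∈ p [ y ]≔ outside
  z∈p[y]≔outside = []≔-minimal⁻ _ z≢x z∈p′
  z≢y : z ≢ y
  z≢y refl with []=-injective z∈p[y]≔outside ([]≔-updates p y)
  ... | ()

x∈p⇒∣p∣≡1+∣p[x]≔outside∣ : ∀ {p : Subset n} {x} → x ∈ p → ∣ p ∣ ≡ suc ∣ p [ x ]≔ outside ∣
x∈p⇒∣p∣≡1+∣p[x]≔outside∣ {p = inside ∷ p} here = refl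
x∈p⇒∣p∣≡1+∣p[x]≔outside∣ {p = inside ∷ p} (there x∈p) = cong suc (x∈p⇒∣p∣≡1+∣p[x]≔outside∣ x∈p)
x∈p⇒∣p∣≡1+∣p[x]≔outside∣ {p = outside ∷ p} (there x∈p) = x∈p⇒∣p∣≡1+∣p[x]≔outside∣ x∈p

x∉p⇒∣p[x]≔inside∣≡1+∣p∣ : ∀ (p : Subset n) x → x ∉ p → ∣ p [ x ]≔ inside ∣ ≡ suc ∣ p ∣
x∉p⇒∣p[x]≔inside∣≡1+∣p∣ (inside ∷ p) Fin.zero x∉p = contradiction here x∉p
x∉p⇒∣p[x]≔inside∣≡1+∣p∣ (outside ∷ p) Fin.zero x∉p = refl
x∉p⇒∣p[x]≔inside∣≡1+∣p∣ (inside ∷ p) (Fin.suc x) x∉p =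
  cong suc (x∉p⇒∣p[x]≔inside∣≡1+∣p∣ p x (x∉p ∘ there))
x∉p⇒∣p[x]≔inside∣≡1+∣p∣ (outside ∷ p) (Fin.suc x) x∉p =
  x∉p⇒∣p[x]≔inside∣≡1+∣p∣ p x (x∉p ∘ there)

∣replace∣ : ∀ {p : Subset n} {y x} → y ∈ p → x ∉ p → ∣ replace p y x ∣ ≡ ∣ p ∣
∣replace∣ {p = p} {y} {x} y∈p x∉p = begin
  ∣ replace p y x ∣          ≡⟨ x∉p⇒∣p[x]≔inside∣≡1+∣p∣ _ x x∉p[y]≔outside ⟩
  suc ∣ p [ y ]≔ outside ∣   ≡⟨ sym (x∈p⇒∣p∣≡1+∣p[x]≔outside∣ y∈p) ⟩
  ∣ p ∣                      ∎
  where
  open ≡-Reasoning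
  x∉p[y]≔outside : x ∉ p [ y ]≔ outside
  x∉p[y]≔outside x∈ = x∉p ([]≔-minimal⁻ p (λ { refl → x∉p y∈p }) x∈)

Empty-∩⇒∣p∪q∣≡∣p∣+∣q∣ : ∀ (p q : Subset n) → Empty (p ∩ q) → ∣ p ∪ q ∣ ≡ ∣ p ∣ + ∣ q ∣
Empty-∩⇒∣p∪q∣≡∣p∣+∣q∣ [] [] _ = refl
Empty-∩⇒∣p∪q∣≡∣p∣+∣q∣ (inside ∷ p) (inside ∷ q) empty = contradiction (Fin.zero , here) empty
Empty-∩⇒∣p∪q∣≡∣p∣+∣q∣ (inside ∷ p) (outside ∷ q) empty =
  cong suc (Empty-∩⇒∣p∪q∣≡∣p∣+∣q∣ p q (drop-∷-Empty empty))
Empty-∩⇒∣p∪q∣≡∣p∣+∣q∣ (outside ∷ p) (inside ∷ q) empty =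
  trans (cong suc (Empty-∩⇒∣p∪q∣≡∣p∣+∣q∣ p q (drop-∷-Empty empty))) (sym (+-suc ∣ p ∣ ∣ q ∣))
Empty-∩⇒∣p∪q∣≡∣p∣+∣q∣ (outside ∷ p) (outside ∷ q) empty =
  Empty-∩⇒∣p∪q∣≡∣p∣+∣q∣ p q (drop-∷-Empty empty)

∈⋃⁻ : ∀ (L : List (Subset n)) {x} → x ∈ ⋃ L → Any (x ∈_) L
∈⋃⁻ [] x∈⊥ = contradiction x∈⊥ ∉⊥
∈⋃⁻ (B ∷ L) x∈B∪⋃L with x∈p∪q⁻ B (⋃ L) x∈B∪⋃L
... | inj₁ x∈B = Any.here x∈B
... | inj₂ x∈⋃L = Any.there (∈⋃⁻ L x∈⋃L)

⋃-resp-↭ : ∀ {L L′ : List (Subset n)} → L ↭ L′ → ⋃ L ≡ ⋃ L′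
⋃-resp-↭ {n} π = foldr-commMonoid (setoid (Subset n)) (∪-isCommutativeMonoid n) (↭⇒↭ₛ π)

record SharedVertex (L : List (Subset n)) : Set where
  constructor shared
  field
    vertex : Fin n
    block : Subset n
    others : List (Subset n)
    split : L ↭ block ∷ others
    ∈block : vertex ∈ block
    ∈others : vertex ∈ ⋃ others

sharedVertex⊎∑∣B∣≤∣⋃∣ : ∀ (L : List (Subset n)) → SharedVertex L ⊎ sum (map ∣_∣ L) ≤ ∣ ⋃ L ∣
sharedVertex⊎∑∣B∣≤∣⋃∣ [] = inj₂ z≤n
sharedVertex⊎∑∣B∣≤∣⋃∣ (B ∷ L) with sharedVertex⊎∑∣B∣≤∣⋃∣ L
... | inj₁ (shared y C R L↭C∷R y∈C y∈⋃R) =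
  inj₁ (shared y C (B ∷ R) (↭-trans (prep B L↭C∷R) (swap B C ↭-refl)) y∈C (q⊆p∪q B (⋃ R) y∈⋃R))
... | inj₂ ∑≤∣⋃L∣ with nonempty? (B ∩ ⋃ L)
...   | no empty = inj₂ (≤-trans (+-monoʳ-≤ ∣ B ∣ ∑≤∣⋃L∣)
                                 (≤-reflexive (sym (Empty-∩⇒∣p∪q∣≡∣p∣+∣q∣ B (⋃ L) empty))))
...   | yes (y , y∈B∩⋃L) with x∈p∩q⁻ B (⋃ L) y∈B∩⋃L
...     | y∈B , y∈⋃L = inj₁ (shared y B L ↭-refl y∈B y∈⋃L)

∈-replace-∩⁺ : ∀ {B D : Subset n} {y x z} → z ≢ y → z ∈ B ∩ D → z ∈ replace B y x ∩ D
∈-replace-∩⁺ {B = B} {D} z≢y z∈B∩D with x∈p∩q⁻ B D z∈B∩D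
... | z∈B , z∈D = x∈p∩q⁺ (∈-replace⁺ z≢y z∈B , z∈D)

∈-∩-replace⁻ : ∀ {C D : Subset n} {y x z} → x ∉ C → z ∈ C ∩ replace D y x → z ≢ y × z ∈ C ∩ D
∈-∩-replace⁻ {C = C} {D} {y} {x} x∉C z∈C∩D′ with x∈p∩q⁻ C (replace D y x) z∈C∩D′
... | z∈C , z∈D′ with ∈-replace⁻ {p = D} z∈D′
...   | inj₁ refl = contradiction z∈C x∉C
...   | inj₂ (z≢y , z∈D) = z≢y , x∈p∩q⁺ (z∈C , z∈D)

∩⊆replace-∩ : ∀ (B : Subset n) {D y} x → y ∉ D → B ∩ D ⊆ replace B y x ∩ D
∩⊆replace-∩ B {D} x y∉D z∈B∩D =
  ∈-replace-∩⁺ (λ { refl → y∉D (proj₂ (x∈p∩q⁻ B D z∈B∩D)) }) z∈B∩D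

replace-∩⊆replace-∩ : ∀ (B : Subset n) {D} y {x} → x ∈ D → replace (B ∩ D) y x ⊆ replace B y x ∩ D
replace-∩⊆replace-∩ B {D} y {x} x∈D z∈′ with ∈-replace⁻ {p = B ∩ D} z∈′
... | inj₁ refl = x∈p∩q⁺ (x∈replace B y x , x∈D)
... | inj₂ (z≢y , z∈B∩D) = ∈-replace-∩⁺ z≢y z∈B∩D

∩-replace⊆replace-∩ : ∀ {B : Subset n} D y {x} → x ∉ B → B ∩ replace D y x ⊆ replace B y x ∩ D
∩-replace⊆replace-∩ D y x∉B z∈′ with ∈-∩-replace⁻ x∉B z∈′
... | z≢y , z∈B∩D = ∈-replace-∩⁺ z≢y z∈B∩D

∩-replace⊆∩ : ∀ {C : Subset n} D y {x} → x ∉ C → C ∩ replace D y x ⊆ C ∩ D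
∩-replace⊆∩ D y x∉C = proj₂ ∘ ∈-∩-replace⁻ x∉C

All×Any⇒Any× : ∀ {A : Set} {P Q : A → Set} {xs} → All P xs → Any Q xs → Any (λ x → P x × Q x) xs
All×Any⇒Any× (px ∷ _) (Any.here qx) = Any.here (px , qx)
All×Any⇒Any× (_ ∷ pxs) (Any.there qxs) = Any.there (All×Any⇒Any× pxs qxs)

Hits : ℕ → ℕ → List (Subset n) → Set
Hits {n} p t 𝓑 = (D : Subset n) → ∣ D ∣ ≡ p → Any (λ B → t ≤ ∣ B ∩ D ∣) 𝓑

replace-preserves-Hits : ∀ {p t} {B : Subset n} {R y x} → y ∈ B → x ∉ B → All (x ∉_) R →
  Hits p t (B ∷ R) → Hits p t (replace B y x ∷ R)
replace-preserves-Hits {t = t} {B} {R} {y} {x} y∈B x∉B x∉R hits D ∣D∣≡p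
  with hits D ∣D∣≡p | y ∈? D | x ∈? D
... | Any.there hitR | _ | _ = Any.there hitR
... | Any.here hitB | no y∉D | _ = Any.here (≤-trans hitB (p⊆q⇒∣p∣≤∣q∣ (∩⊆replace-∩ B x y∉D)))
... | Any.here hitB | yes y∈D | yes x∈D = Any.here (begin
  t                        ≤⟨ hitB ⟩
  ∣ B ∩ D ∣                ≡⟨ ∣replace∣ (x∈p∩q⁺ (y∈B , y∈D)) (x∉B ∘ proj₁ ∘ x∈p∩q⁻ B D) ⟨
  ∣ replace (B ∩ D) y x ∣  ≤⟨ p⊆q⇒∣p∣≤∣q∣ (replace-∩⊆replace-∩ B y x∈D) ⟩
  ∣ replace B y x ∩ D ∣    ∎)
  where open ≤-Reasoning
-- Only B is known to meet D in t points, and the exchange may cost it y. Apply the design to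
-- the draw D - y + x instead: as x lies in no old block, whichever block meets that draw in
-- t points meets D at least as well after the exchange.
... | Any.here _ | yes y∈D | no x∉D with hits (replace D y x) (trans (∣replace∣ y∈D x∉D) ∣D∣≡p)
...   | Any.here hitB = Any.here (≤-trans hitB (p⊆q⇒∣p∣≤∣q∣ (∩-replace⊆replace-∩ D y x∉B)))
...   | Any.there hitR =
  Any.there (Any.map (λ (x∉C , hitC) → ≤-trans hitC (p⊆q⇒∣p∣≤∣q∣ (∩-replace⊆∩ D y x∉C)))
                     (All×Any⇒Any× x∉R hitR))

IsLotteryDesign-resp-↭ : ∀ {k p t j} {L L′ : List (Subset n)} → L ↭ L′ →
  IsLotteryDesign n k p t j L → IsLotteryDesign n k p t j L′
IsLotteryDesign-resp-↭ {n} L↭L′ ((unique , len , sizes) , hits) =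
  ( ( Unique-resp-↭ (setoid (Subset n)) (↭⇒↭ₛ L↭L′) unique
    , trans (sym (↭-length L↭L′)) len
    , All-resp-↭ L↭L′ sizes )
  , λ D ∣D∣≡p → Any-resp-↭ L↭L′ (hits D ∣D∣≡p) )

replace-preserves-IsLotteryDesign : ∀ {k p t j} {B : Subset n} {R y x} → y ∈ B → ¬ Any (x ∈_) (B ∷ R) →
  IsLotteryDesign n k p t j (B ∷ R) → IsLotteryDesign n k p t j (replace B y x ∷ R)
replace-preserves-IsLotteryDesign {B = B} {R} {y} {x} y∈B x-uncovered
  (((_ ∷ unique) , len , (∣B∣≡k ∷ sizes)) , hits) =
  ( ((B′∉R ∷ unique) , len , (trans (∣replace∣ y∈B x∉B) ∣B∣≡k ∷ sizes))
  , replace-preserves-Hits y∈B x∉B x∉R hits )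
  where
  x∉B : x ∉ B
  x∉B = x-uncovered ∘ Any.here
  x∉R : All (x ∉_) R
  x∉R = ¬Any⇒All¬ R (x-uncovered ∘ Any.there)
  B′∉R : All (replace B y x ≢_) R
  B′∉R = All.map (λ x∉C B′≡C → x∉C (subst (x ∈_) B′≡C (x∈replace B y x))) x∉R

⋃-replace-⊂ : ∀ {B : Subset n} {R y x} → y ∈ B → y ∈ ⋃ R → x ∉ ⋃ (B ∷ R) →
  ⋃ (B ∷ R) ⊂ ⋃ (replace B y x ∷ R)
⋃-replace-⊂ {B = B} {R} {y} {x} y∈B y∈⋃R x∉⋃ = ⊆ , x , p⊆p∪q (⋃ R) (x∈replace B y x) , x∉⋃
  where
  ⊆ : ⋃ (B ∷ R) ⊆ ⋃ (replace B y x ∷ R)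
  ⊆ {z} z∈⋃ with x∈p∪q⁻ B (⋃ R) z∈⋃ | z ≟ y
  ... | inj₂ z∈⋃R | _ = q⊆p∪q _ (⋃ R) z∈⋃R
  ... | inj₁ _ | yes refl = q⊆p∪q _ (⋃ R) y∈⋃R
  ... | inj₁ z∈B | no z≢y = p⊆p∪q (⋃ R) (∈-replace⁺ z≢y z∈B)

x∉p⇒∣p∣<n : ∀ {p : Subset n} {x} → x ∉ p → ∣ p ∣ < n
x∉p⇒∣p∣<n {n} {p} {x} x∉p = subst (∣ p ∣ <_) (∣⊤∣≡n n) (p⊂q⇒∣p∣<∣q∣ {q = ⊤} ((λ _ → ∈⊤) , x , ∈⊤ , x∉p))

∑∣B∣≡length*k : ∀ {k} (L : List (Subset n)) → All (λ B → ∣ B ∣ ≡ k) L → sum (map ∣_∣ L) ≡ length L * k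
∑∣B∣≡length*k [] [] = refl
∑∣B∣≡length*k (B ∷ L) (∣B∣≡k ∷ sizes) = cong₂ _+_ ∣B∣≡k (∑∣B∣≡length*k L sizes)

uncovered⇒SharedVertex : ∀ {k j} {L : List (Subset n)} {x} → IsUniformHypergraph n k j L →
  n ≤ j * k → x ∉ ⋃ L → SharedVertex L
uncovered⇒SharedVertex {n} {k} {j} {L} (_ , len , sizes) n≤jk x∉⋃L with sharedVertex⊎∑∣B∣≤∣⋃∣ L
... | inj₁ shared-vertex = shared-vertex
... | inj₂ ∑≤∣⋃L∣ = contradiction n≤∣⋃L∣ (<⇒≱ (x∉p⇒∣p∣<n x∉⋃L))
  where
  open ≤-Reasoning
  n≤∣⋃L∣ : n ≤ ∣ ⋃ L ∣
  n≤∣⋃L∣ = begin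
    n                  ≤⟨ n≤jk ⟩
    j * k              ≡⟨ cong (_* k) len ⟨
    length L * k       ≡⟨ ∑∣B∣≡length*k L sizes ⟨
    sum (map ∣_∣ L)    ≤⟨ ∑≤∣⋃L∣ ⟩
    ∣ ⋃ L ∣            ∎

uncovered⇒⋃-extendable : ∀ {k p t j} {L : List (Subset n)} {x} → IsLotteryDesign n k p t j L →
  n ≤ j * k → ¬ Any (x ∈_) L →
  Σ (List (Subset n)) λ L′ → IsLotteryDesign n k p t j L′ × ∣ ⋃ L ∣ < ∣ ⋃ L′ ∣
uncovered⇒⋃-extendable {L = L} {x} design n≤jk x-uncovered
  with uncovered⇒SharedVertex (proj₁ design) n≤jk (x-uncovered ∘ ∈⋃⁻ L)
... | shared y B R L↭B∷R y∈B y∈⋃R =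
  replace B y x ∷ R
  , replace-preserves-IsLotteryDesign y∈B x-uncovered′ (IsLotteryDesign-resp-↭ L↭B∷R design)
  , subst (_< ∣ ⋃ (replace B y x ∷ R) ∣) (cong ∣_∣ (sym (⋃-resp-↭ L↭B∷R)))
          (p⊂q⇒∣p∣<∣q∣ (⋃-replace-⊂ {B = B} {R} y∈B y∈⋃R (x-uncovered′ ∘ ∈⋃⁻ (B ∷ R))))
  where
  x-uncovered′ : ¬ Any (x ∈_) (B ∷ R)
  x-uncovered′ = x-uncovered ∘ Any-resp-↭ (↭-sym L↭B∷R)

Covers⊎uncovered : ∀ (L : List (Subset n)) → Covers L ⊎ ∃ λ x → ¬ Any (x ∈_) L
Covers⊎uncovered {n} L with all? (λ x → any? (x ∈?_) L)
... | yes covers = inj₁ covers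
... | no ¬covers = inj₂ (¬∀⟶∃¬ n _ (λ x → any? (x ∈?_) L) ¬covers)

extend-to-covering : ∀ {k p t j} (fuel : ℕ) (L : List (Subset n)) → IsLotteryDesign n k p t j L →
  n ≤ j * k → n ≤ fuel + ∣ ⋃ L ∣ →
  Σ (List (Subset n)) λ L₀ → IsLotteryDesign n k p t j L₀ × Covers L₀
extend-to-covering {n} fuel L design n≤jk n≤fuel+∣⋃L∣ with Covers⊎uncovered L
... | inj₁ covers = L , design , covers
... | inj₂ (x , x-uncovered) with fuel | uncovered⇒⋃-extendable design n≤jk x-uncovered
...   | zero | _ = contradiction n≤fuel+∣⋃L∣ (<⇒≱ (x∉p⇒∣p∣<n (x-uncovered ∘ ∈⋃⁻ L)))
...   | suc fuel′ | L′ , design′ , ∣⋃L∣<∣⋃L′∣ =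
  extend-to-covering fuel′ L′ design′ n≤jk (begin
    n                          ≤⟨ n≤fuel+∣⋃L∣ ⟩
    suc (fuel′ + ∣ ⋃ L ∣)      ≡⟨ +-suc fuel′ ∣ ⋃ L ∣ ⟨
    fuel′ + suc ∣ ⋃ L ∣        ≤⟨ +-monoʳ-≤ fuel′ ∣⋃L∣<∣⋃L′∣ ⟩
    fuel′ + ∣ ⋃ L′ ∣           ∎)
  where open ≤-Reasoning

lemma3p3 : (n k p t j : ℕ) → k ≤ n → t ≤ k → 2 ≤ t →
    (𝓑 : List (Subset n)) → IsLotteryDesign n k p t j 𝓑 →
    n ≤ j * k →
    Σ (List (Subset n)) (λ 𝓑₀ → IsLotteryDesign n k p t j 𝓑₀ × Covers 𝓑₀)
lemma3p3 n k p t j _ _ _ 𝓑 design n≤jk = extend-to-covering n 𝓑 design n≤jk (m≤m+n n ∣ ⋃ 𝓑 ∣)
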